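{- For any family $(A_i)_{i\in I}$ of sets of locations, $\mathrm{Prom}\bigl(\bigcup_{i\in I}A_i\bigr)=\bigcup_{i\in I}\mathrm{Prom}(A_i)$.
   Context: A lossy channel system (LCS) $\mathcal{L}=(Q,C,M,\Delta)$ has a finite set $Q$ of control locations, finite channels $C$, finite message alphabet $M$, and finite set $\Delta$ of transition rules $q \xrightarrow{op} p$ with $op$ being $c!m$ (send), $c?m$ (receive, enabled only if channel $c$ starts with $m$), or an internal action (no channel operation). Configurations are $(q,w)$ with $w:C\to M^*$; $\epsilon$ is the empty channel valuation. A step fires an enabled rule and then arbitrary messages may be lost. A set $X\subseteq Q$ is promising for $A$ if for every $x\in X$ there is a finite sequence of steps from $(x,\epsilon)$ to a configuration whose location is in $A$, in which all configurations except possibly the last have locations in $X$. $\mathrm{Prom}(A)$ is the largest promising set for $A$ (the union of all promising sets). -}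

module Defs where

open import Level using (0ℓ; suc)
open import Data.Nat using (ℕ)
open import Data.Fin using (Fin; _≟_)
open import Data.List using (List; []; _∷_; _++_; [_])
open import Data.List.Membership.Propositional using (_∈_)
open import Data.List.Relation.Binary.Sublist.Propositional using (_⊆_)
open import Data.Product using (Σ; _×_; _,_; proj₁)
open import Relation.Binary.PropositionalEquality using (_≡_)
open import Relation.Nullary using (yes; no)
open import Relation.Unary using (Pred)

data Op (nC nM : ℕ) : Set where
  send : Fin nC → Fin nM → Op nC nM
  recv : Fin nC → Fin nM → Op nC nM
  internal : Op nC nM

-- A lossy channel system (Q, C, M, Δ) with Q = Fin nQ, C = Fin nC,
-- M = Fin nM (finite sets) and a finite list Δ of rules (q , op , p)
-- meaning  q --op--> p.
record LCS : Set where
  field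
    nQ nC nM : ℕ
    Δ : List (Fin nQ × Op nC nM × Fin nQ)

module _ (L : LCS) where
  open LCS L

  Loc : Set
  Loc = Fin nQ

  Val : Set
  Val = Fin nC → List (Fin nM)

  ε : Val
  ε _ = []

  Conf : Set
  Conf = Loc × Val

  update : Val → Fin nC → List (Fin nM) → Val
  update w c v d with c ≟ d
  ... | yes _ = v
  ... | no _ = w d

  data OpEff : Op nC nM → Val → Val → Set where
    eff-send : ∀ c m w → OpEff (send c m) w (update w c (w c ++ [ m ]))
    eff-recv : ∀ c m w rest → w c ≡ m ∷ rest → OpEff (recv c m) w (update w c rest)
    eff-int : ∀ w → OpEff internal w w

  data Step : Conf → Conf → Set where
    step : ∀ {q op p w w' w''} → (q , op , p) ∈ Δ → OpEff op w w' →
           (∀ c → w'' c ⊆ w' c) → Step (q , w) (p , w'')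

  data ReachVia (X A : Pred Loc 0ℓ) : Conf → Set where
    here : ∀ {γ} → A (proj₁ γ) → ReachVia X A γ
    there : ∀ {γ γ'} → X (proj₁ γ) → Step γ γ' → ReachVia X A γ' → ReachVia X A γ

  Promising : Pred Loc 0ℓ → Pred Loc 0ℓ → Set
  Promising X A = ∀ x → X x → ReachVia X A (x , ε)

  Prom : Pred Loc 0ℓ → Pred Loc (suc 0ℓ)
  Prom A x = Σ (Pred Loc 0ℓ) λ X → Promising X A × X x

module Submission where

-- A run to a target set can be cut at the first moment it leaves a finite set of
-- locations V, and whenever a step is taken all messages may be lost, so every
-- location the run visits can be reached again with empty channels. Starting from
-- V = {x}, follow the run that X provides from the current "top" location of V:
-- either it reaches some A i inside V, and then V is promising for A i, or it
-- leaves V at a new location y of X; adding y to V, every location of the enlarged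
-- set still reaches y with empty channels, so y becomes the new top. Since V grows
-- strictly inside a finite set of locations, the first case eventually occurs.

open import Defs
open import Level using (0ℓ)
open import Data.Fin.Subset using (Subset; _∈_; _⊂_; _⊃_; ⁅_⁆; _∪_)
open import Data.Fin.Subset.Properties using (_∈?_; x∈⁅x⁆; x∈⁅y⁆⇒x≡y; x∈p∪q⁻; p⊆p∪q; q⊆p∪q)
open import Data.Fin.Subset.Induction using (⊃-wellFounded)
open import Data.List.Relation.Binary.Sublist.Propositional using (minimum)
open import Data.Product using (Σ; ∃-syntax; _×_; _,_; proj₁)
open import Data.Sum using (_⊎_; inj₁; inj₂; [_,_])
open import Function using (id)
open import Induction.WellFounded using (Acc; acc)
open import Relation.Binary.PropositionalEquality using (subst; sym)
open import Relation.Nullary using (Dec; yes; no; ¬_)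
open import Relation.Unary using (Pred; ⋃; _⊆_; _≐_)

module _ {L : LCS} where
  open LCS L using (nQ)

  ReachVia-mono : ∀ {X Y A B : Pred (Loc L) 0ℓ} → X ⊆ Y → A ⊆ B → ReachVia L X A ⊆ ReachVia L Y B
  ReachVia-mono X⊆Y A⊆B (here a) = here (A⊆B a)
  ReachVia-mono X⊆Y A⊆B (there x s r) = there (X⊆Y x) s (ReachVia-mono X⊆Y A⊆B r)

  ReachVia-⋃ : ∀ {X : Pred (Loc L) 0ℓ} {I : Set} {A : I → Pred (Loc L) 0ℓ} {γ} →
    ReachVia L X (⋃ I A) γ → ∃[ i ] ReachVia L X (A i) γ
  ReachVia-⋃ (here (i , a)) = i , here a
  ReachVia-⋃ (there x s r) with ReachVia-⋃ r
  ... | i , r′ = i , there x s r′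

  Step-loseAll : ∀ {γ y w} → Step L γ (y , w) → Step L γ (y , ε L)
  Step-loseAll (step rule eff _) = step rule eff (λ c → minimum _)

  data ReachEmpty (V : Pred (Loc L) 0ℓ) : Conf L → Loc L → Set where
    done : ∀ {y} → ReachEmpty V (y , ε L) y
    there : ∀ {γ γ′ y} → V (proj₁ γ) → Step L γ γ′ → ReachEmpty V γ′ y → ReachEmpty V γ y

  ReachEmpty-mono : ∀ {V W : Pred (Loc L) 0ℓ} {γ y} → V ⊆ W → ReachEmpty V γ y → ReachEmpty W γ y
  ReachEmpty-mono V⊆W done = done
  ReachEmpty-mono V⊆W (there v s r) = there (V⊆W v) s (ReachEmpty-mono V⊆W r)

  ReachEmpty-trans : ∀ {V γ y z} → ReachEmpty V γ y → ReachEmpty V (y , ε L) z → ReachEmpty V γ z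
  ReachEmpty-trans done r′ = r′
  ReachEmpty-trans (there v s r) r′ = there v s (ReachEmpty-trans r r′)

  ReachEmpty-ReachVia : ∀ {V B γ y} → ReachEmpty V γ y → ReachVia L V B (y , ε L) → ReachVia L V B γ
  ReachEmpty-ReachVia done r′ = r′
  ReachEmpty-ReachVia (there v s r) r′ = there v s (ReachEmpty-ReachVia r r′)

  ReachVia-exit : ∀ {V X B : Pred (Loc L) 0ℓ} {γ} → (∀ v → Dec (V v)) → V (proj₁ γ) →
    ReachVia L X B γ → ReachVia L V B γ ⊎ ∃[ y ] (X y × ¬ V y × ReachEmpty V γ y)
  ReachVia-exit V? v (here b) = inj₁ (here b)
  ReachVia-exit V? v (there {γ' = γ′} x s r) with V? (proj₁ γ′) | r
  ... | no ¬v′ | here b = inj₁ (there v s (here b))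
  ... | no ¬v′ | there x′ _ _ = inj₂ (proj₁ γ′ , x′ , ¬v′ , there v (Step-loseAll s) done)
  ... | yes v′ | r′ with ReachVia-exit V? v′ r′
  ...   | inj₁ q = inj₁ (there v s q)
  ...   | inj₂ (y , x″ , ¬v″ , e) = inj₂ (y , x″ , ¬v″ , there v s e)

  ∈⁅⁆-elim : ∀ {P : Pred (Loc L) 0ℓ} y → P y → (_∈ ⁅ y ⁆) ⊆ P
  ∈⁅⁆-elim {P} y Py v∈ = subst P (sym (x∈⁅y⁆⇒x≡y y v∈)) Py

  ∈⁅⁆-ReachEmpty : ∀ {V : Pred (Loc L) 0ℓ} y {v} → v ∈ ⁅ y ⁆ → ReachEmpty V (v , ε L) y
  ∈⁅⁆-ReachEmpty {V} y = ∈⁅⁆-elim {P = λ v → ReachEmpty V (v , ε L) y} y done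

  record Basin (X : Pred (Loc L) 0ℓ) (V : Subset nQ) (top : Loc L) : Set where
    field
      inside : (_∈ V) ⊆ X
      top∈ : top ∈ V
      drains : ∀ {v} → v ∈ V → ReachEmpty (_∈ V) (v , ε L) top

  open Basin

  basin-⁅_⁆ : ∀ {X : Pred (Loc L) 0ℓ} x → X x → Basin X ⁅ x ⁆ x
  basin-⁅ x ⁆ Xx = record
    { inside = ∈⁅⁆-elim x Xx
    ; top∈ = x∈⁅x⁆ x
    ; drains = ∈⁅⁆-ReachEmpty x
    }

  basin-extend : ∀ {X : Pred (Loc L) 0ℓ} {V top y} → Basin X V top → X y →
    ReachEmpty (_∈ V) (top , ε L) y → Basin X (⁅ y ⁆ ∪ V) y
  basin-extend {V = V} {y = y} b Xy top⇝y = record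
    { inside = λ v∈ → [ ∈⁅⁆-elim y Xy , inside b ] (x∈p∪q⁻ ⁅ y ⁆ V v∈)
    ; top∈ = p⊆p∪q V (x∈⁅x⁆ y)
    ; drains = λ v∈ → [ ∈⁅⁆-ReachEmpty y , via-top ] (x∈p∪q⁻ ⁅ y ⁆ V v∈)
    }
    where
    via-top : ∀ {v} → v ∈ V → ReachEmpty (_∈ ⁅ y ⁆ ∪ V) (v , ε L) y
    via-top v∈ = ReachEmpty-mono (q⊆p∪q ⁅ y ⁆ V) (ReachEmpty-trans (drains b v∈) top⇝y)

  basin-promising : ∀ {X B V top} → Basin X V top → ReachVia L (_∈ V) B (top , ε L) →
    Promising L (_∈ V) B
  basin-promising b r v v∈ = ReachEmpty-ReachVia (drains b v∈) r

  basin-extends-to-promising : ∀ {X : Pred (Loc L) 0ℓ} {I : Set} {A : I → Pred (Loc L) 0ℓ} {V top} →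
    Promising L X (⋃ I A) → Basin X V top → Acc _⊃_ V →
    ∃[ i ] Σ (Subset nQ) λ W → (_∈ V) ⊆ (_∈ W) × Promising L (_∈ W) (A i)
  basin-extends-to-promising {V = V} {top} PX b (acc _)
    with ReachVia-exit (_∈? V) (top∈ b) (PX top (inside b (top∈ b)))
  ... | inj₁ r with ReachVia-⋃ r
  ...   | i , rᵢ = i , V , id , basin-promising b rᵢ
  basin-extends-to-promising {V = V} PX b (acc rec) | inj₂ (y , Xy , y∉V , top⇝y)
    with basin-extends-to-promising PX (basin-extend b Xy top⇝y) (rec V⊂V′)
    where
    V⊂V′ : V ⊂ ⁅ y ⁆ ∪ V
    V⊂V′ = q⊆p∪q ⁅ y ⁆ V , y , p⊆p∪q V (x∈⁅x⁆ y) , y∉V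
  ... | i , W , V′⊆W , PW = i , W , (λ v∈ → V′⊆W (q⊆p∪q ⁅ y ⁆ V v∈)) , PW

Prom-⋃⊆⋃-Prom : ∀ (L : LCS) (I : Set) (A : I → Pred (Loc L) 0ℓ) →
  Prom L (⋃ I A) ⊆ ⋃ I (λ i → Prom L (A i))
Prom-⋃⊆⋃-Prom L I A {x} (X , PX , Xx)
  with basin-extends-to-promising PX (basin-⁅ x ⁆ Xx) (⊃-wellFounded ⁅ x ⁆)
... | i , W , ⁅x⁆⊆W , PW = i , (_∈ W) , PW , ⁅x⁆⊆W (x∈⁅x⁆ x)

⋃-Prom⊆Prom-⋃ : ∀ (L : LCS) (I : Set) (A : I → Pred (Loc L) 0ℓ) →
  ⋃ I (λ i → Prom L (A i)) ⊆ Prom L (⋃ I A)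
⋃-Prom⊆Prom-⋃ L I A (i , X , PX , Xx) = X , (λ v Xv → ReachVia-mono id (i ,_) (PX v Xv)) , Xx

lemma3p5 : (L : LCS) (I : Set) (A : I → Pred (Loc L) 0ℓ) →
    Prom L (⋃ I A) ≐ ⋃ I (λ i → Prom L (A i))
lemma3p5 L I A = Prom-⋃⊆⋃-Prom L I A , ⋃-Prom⊆Prom-⋃ L I A
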